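{- Let $G=(V,E)$ be a finite oriented graph, $T\subseteq E$ a spanning forest, $\overline{T}=E\setminus T$, and $C\in\{0,\pm1\}^{\overline{T}\times E}$ the fundamental cycle matrix with respect to $T$. Let $P=[0,1]^{\overline{T}}$, with interior $P^\circ=(0,1)^{\overline{T}}$, and let $\mathcal{H}$ be the (infinite) arrangement of hyperplanes $H_{e,d}=\{q\in\mathbb{R}^{\overline{T}}: C_{\bullet e}^{T} q=d\}$ for $e\in T$ and $d\in\mathbb{Z}$, where $C_{\bullet e}$ is the column of $C$ indexed by $e$. Then for every positive integer $k$, $$\overline{\varphi}_G(k)=\Bigl|\,k\cdot\bigl(P^\circ\setminus \textstyle\bigcup\mathcal{H}\bigr)\cap\mathbb{Z}^{\overline{T}}\Bigr|.$$
   Context: Oriented graphs may have loops and multiple edges. A spanning forest is a set of edges forming a spanning tree in each connected component. For $f\in\overline{T}$, the graph $(V,T\cup\{f\})$ contains a unique undirected cycle $K_f$ (for a loop $f$, $K_f=\{f\}$); orient $K_f$ as a directed cycle agreeing with the orientation of $f$. The row $C_{f\bullet}$ has $C_{f,e}=0$ for $e\notin K_f$, $C_{f,e}=1$ if $e\in K_f$ is oriented in $G$ as in this directed cycle, and $C_{f,e}=-1$ if $e\in K_f$ must be reversed. A $\mathbb{Z}_k$-flow is a map $f:E\to\mathbb{Z}_k$ such that at each vertex the sum of values on entering edges minus the sum on leaving edges is $0$; it is nowhere-zero if it takes no zero value. $\overline{\varphi}_G(k)$ is the number of nowhere-zero $\mathbb{Z}_k$-flows of $G$. -}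

module Defs where

open import Data.Nat as ℕ using (ℕ; zero; suc; NonZero)
open import Data.Integer as ℤ using (ℤ; +_)
open import Data.Integer.Divisibility using () renaming (_∣_ to _∣ℤ_)
open import Data.Rational as ℚ using (ℚ; 0ℚ; 1ℚ)
open import Data.Fin using (Fin; zero; suc; toℕ; _≟_)
open import Data.Fin.Subset using (Subset; _∈_; _∉_)
open import Data.Bool using (Bool; true; false; if_then_else_)
open import Data.List using (List; []; _∷_; map; length)
open import Data.List.Membership.Propositional using () renaming (_∈_ to _∈ₗ_; _∉_ to _∉ₗ_)
open import Data.List.Relation.Unary.Unique.Propositional using (Unique)
open import Data.Vec using (Vec; lookup)
open import Data.Product using (Σ; ∃; ∃-syntax; _×_; _,_; proj₁)
open import Data.Sum using (_⊎_)
open import Relation.Nullary using (¬_; does)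
open import Relation.Binary.PropositionalEquality using (_≡_)
open import Function.Bundles using (_⇔_)

-- Finite oriented graphs: vertices Fin n, edges Fin m, each edge has a
-- tail (src) and a head (tgt).  Loops and multiple edges are allowed.

record Graph (n m : ℕ) : Set where
  field
    src : Fin m → Fin n
    tgt : Fin m → Fin n
open Graph public

sumℤ : ∀ {m} → (Fin m → ℤ) → ℤ
sumℤ {zero}  f = + 0
sumℤ {suc m} f = f zero ℤ.+ sumℤ (λ i → f (suc i))

sumℚ : ∀ {m} → (Fin m → ℚ) → ℚ
sumℚ {zero}  f = 0ℚ
sumℚ {suc m} f = f zero ℚ.+ sumℚ (λ i → f (suc i))

-- Walks and cycles.  A dart is an edge together with a direction of
-- traversal (true = along its orientation, src → tgt).

Dart : ℕ → Set
Dart m = Fin m × Bool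

module _ {n m : ℕ} (G : Graph n m) where

  dstart : Dart m → Fin n
  dstart (e , true)  = src G e
  dstart (e , false) = tgt G e

  dend : Dart m → Fin n
  dend (e , true)  = tgt G e
  dend (e , false) = src G e

  Chain : Fin n → List (Dart m) → Fin n → Set
  Chain u []       v = u ≡ v
  Chain u (d ∷ ds) v = dstart d ≡ u × Chain (dend d) ds v

  AllIn : (Fin m → Set) → List (Dart m) → Set
  AllIn S []       = Data.Unit.⊤ where import Data.Unit
  AllIn S (d ∷ ds) = S (proj₁ d) × AllIn S ds

  IsCycle : (Fin m → Set) → List (Dart m) → Set
  IsCycle S ds =
    ¬ (ds ≡ []) × (∃[ u ] Chain u ds u) × AllIn S ds ×
    Unique (map proj₁ ds) × Unique (map dstart ds)

  IsForest : Subset m → Set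
  IsForest T = ∀ ds → ¬ IsCycle (_∈ T) ds

  IsSpanning : Subset m → Set
  IsSpanning T = ∀ e → ∃[ ds ] (AllIn (_∈ T) ds × Chain (src G e) ds (tgt G e))

  IsSpanningForest : Subset m → Set
  IsSpanningForest T = IsForest T × IsSpanning T

  -- C is the fundamental cycle matrix w.r.t. T: for each f ∉ T, the row
  -- C f is the signed incidence vector of the (unique) cycle K_f of T ∪ {f},
  -- oriented so that f is traversed along its orientation.
  -- (Rows indexed by f ∈ T are irrelevant and unconstrained.)
  IsFundCycleMatrix : Subset m → (Fin m → Fin m → ℤ) → Set
  IsFundCycleMatrix T C =
    ∀ f → f ∉ T → ∃[ ds ]
      ( IsCycle (λ e → e ∈ T ⊎ e ≡ f) ds
      × (f , true) ∈ₗ ds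
      × (∀ e → (e , true)  ∈ₗ ds → C f e ≡ ℤ.+ 1)
      × (∀ e → (e , false) ∈ₗ ds → C f e ≡ ℤ.- (ℤ.+ 1))
      × (∀ e → e ∉ₗ map proj₁ ds → C f e ≡ + 0) )

  -- ℤ_k-flows.  ℤ_k is represented by Fin k; a flow is a vector of
  -- values indexed by the edges.  The conservation law in ℤ_k at v says
  -- that k divides (inflow − outflow) computed on representatives.

  val : ∀ {k} → Vec (Fin k) m → Fin m → ℤ
  val φ e = + toℕ (lookup φ e)

  IsFlow : (k : ℕ) → Vec (Fin k) m → Set
  IsFlow k φ = ∀ v →
    (+ k) ∣ℤ (sumℤ (λ e → if does (tgt G e ≟ v) then val φ e else + 0)
              ℤ.- sumℤ (λ e → if does (src G e ≟ v) then val φ e else + 0))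

  NowhereZeroFlow : (k : ℕ) → Vec (Fin k) m → Set
  NowhereZeroFlow k φ = IsFlow k φ × (∀ e → ¬ (toℕ (lookup φ e) ≡ 0))

-- The lattice-point side.  ℝ^{T̄} points with coordinates rational are
-- represented by q : Fin m → ℚ, reading only the coordinates f ∉ T.

module _ {m : ℕ} (T : Subset m) where

  InOpenCube : (Fin m → ℚ) → Set
  InOpenCube q = ∀ f → f ∉ T → (0ℚ ℚ.< q f) × (q f ℚ.< 1ℚ)

  sumT̄ : (Fin m → ℚ) → ℚ
  sumT̄ g = sumℚ (λ f → if does (Data.Fin.Subset.Properties._∈?_ f T) then 0ℚ else g f)
    where import Data.Fin.Subset.Properties

  OnHyperplane : (Fin m → Fin m → ℤ) → Fin m → ℤ → (Fin m → ℚ) → Set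
  OnHyperplane C e d q = sumT̄ (λ f → (C f e ℚ./ 1) ℚ.* q f) ≡ (d ℚ./ 1)

  InArrangement : (Fin m → Fin m → ℤ) → (Fin m → ℚ) → Set
  InArrangement C q = ∃[ e ] (e ∈ T × ∃[ d ] OnHyperplane C e d q)

  -- z ∈ k·(P° ∖ ⋃𝓗) ∩ ℤ^{T̄}, with ℤ^{T̄} embedded in ℤ^E as the vectors
  -- vanishing on T; z ∈ k·X iff z/k ∈ X.
  LatticePoint : (C : Fin m → Fin m → ℤ) (k : ℕ) .{{_ : NonZero k}} → Vec ℤ m → Set
  LatticePoint C k z =
    (∀ e → e ∈ T → lookup z e ≡ + 0) ×
    InOpenCube q × ¬ InArrangement C q
    where
      q : Fin m → ℚ
      q f = lookup z f ℚ./ k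

HasSize : ∀ {A : Set} → (A → Set) → ℕ → Set
HasSize {A} P N = ∃[ xs ] (Unique xs × length xs ≡ N × (∀ x → P x ⇔ x ∈ₗ xs))

module Submission where

-- Write y = zC for z ∈ ℤ^{T̄} (extended by 0 on T).  The rows of C
-- are signed cycle vectors, so y is an integer circulation, and y agrees
-- with z on T̄ because C restricted to T̄ × T̄ is the identity.  Hence a
-- lattice point z gives the ℤ_k-flow "y mod k"; it is nowhere zero because
-- 0 < z < k on T̄ and because z/k avoiding every H_{e,d} (e ∈ T) says exactly
-- that k ∤ y_e.  Conversely a flow φ gives the point z = φ|_{T̄}.  These maps
-- are mutually inverse: the only nontrivial direction rests on the forest
-- lemma (a vector with all net flows ≡ 0 mod k that is ≡ 0 mod k off a
-- forest is ≡ 0 mod k everywhere), applied to φ - zC.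

open import Defs
open import Data.Nat as ℕ using (ℕ; zero; suc; NonZero)
import Data.Nat.Properties as ℕP
import Data.Nat.DivMod as ℕDM
import Data.Nat.Divisibility as ℕD
open import Data.Integer as ℤ using (ℤ; +_; _+_; _*_; _-_; -_)
import Data.Integer.Properties as ℤP
import Data.Integer.DivMod as ℤDM
open import Data.Integer.Tactic.RingSolver using (solve-∀)
open import Data.Integer.Divisibility.Signed as ∣ℤ using (divides)
open import Data.Rational as ℚ using (ℚ; 0ℚ; 1ℚ; toℚᵘ)
import Data.Rational.Properties as ℚP
open import Data.Rational.Unnormalised as ℚᵘ using (mkℚᵘ; *≡*; *<*; _≃_)
import Data.Rational.Unnormalised.Properties as ℚᵘP
open import Data.Fin using (Fin; zero; suc; _≟_; punchIn; toℕ; fromℕ<)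
import Data.Fin.Properties as FinP
open import Data.Fin.Subset using (Subset; _∈_; _∉_)
open import Data.Fin.Subset.Properties using (_∈?_)
open import Data.Bool using (true; false; if_then_else_)
open import Data.Product using (Σ; ∃₂; ∃-syntax; _×_; _,_; proj₁; proj₂)
open import Data.Sum using (_⊎_; inj₁; inj₂)
open import Data.List as List using (List; []; _∷_; map; _++_; length)
import Data.List.Properties as LP
import Data.List.Relation.Unary.All.Properties as AllP
open import Data.List.Relation.Unary.Any using (here; there)
open import Data.List.Relation.Unary.All as All using (All; []; _∷_)
open import Data.List.Relation.Unary.AllPairs using ([]; _∷_)
open import Data.List.Relation.Unary.Unique.Propositional using (Unique)
open import Data.List.Membership.Propositional using () renaming (_∈_ to _∈ₗ_; _∉_ to _∉ₗ_)
open import Data.List.Membership.Propositional.Properties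
  using (∈-map⁺; ∈-map⁻; ∈-lookup; ∈-++⁺ˡ; ∈-allFin; ∈-cartesianProductWith⁺; ∈-filter⁺; ∈-filter⁻)
import Data.List.Relation.Unary.Unique.Propositional.Properties as UP
import Data.List.Membership.DecPropositional as DecMembership
open import Data.Vec using (Vec; []; _∷_; lookup; tabulate)
import Data.Vec.Properties as VecP
open import Function.Bundles using (mk⇔; Equivalence)
open import Function using (_∘_)
open import Data.Unit using (tt)
open import Relation.Nullary using (¬_; ¬?; does; yes; no; Dec; _×-dec_)
open import Relation.Nullary.Decidable using (dec-true; dec-false)
open import Relation.Binary.PropositionalEquality
open import Data.Empty using (⊥; ⊥-elim)
open import Algebra.Properties.Semiring.Sum ℤP.+-*-semiring
  using (sum; sum-syntax; ∑-distrib-+; ∑-comm; *-distribˡ-sum; sum-cong-≗; sum-remove; sum-replicate-zero)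

sumℤ≡∑ : ∀ {m} (f : Fin m → ℤ) → sumℤ f ≡ ∑[ i < m ] f i
sumℤ≡∑ {zero}  f = refl
sumℤ≡∑ {suc m} f = cong (_+_ (f zero)) (sumℤ≡∑ (f ∘ suc))

∑-zero : ∀ {m} (f : Fin m → ℤ) → (∀ i → f i ≡ + 0) → ∑[ i < m ] f i ≡ + 0
∑-zero {m} f f≡0 = trans (sum-cong-≗ f≡0) (sum-replicate-zero m)

∑-single : ∀ {m} (f : Fin m → ℤ) i → (∀ j → j ≢ i → f j ≡ + 0) → ∑[ j < m ] f j ≡ f i
∑-single {suc m} f i others≡0 = begin
  sum f                        ≡⟨ sum-remove f ⟩
  f i + sum (f ∘ punchIn i)    ≡⟨ cong (_+_ (f i)) (∑-zero _ (λ j → others≡0 _ (FinP.punchInᵢ≢i i j))) ⟩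
  f i + + 0                    ≡⟨ ℤP.+-identityʳ (f i) ⟩
  f i                          ∎
  where open ≡-Reasoning

∑-distrib-- : ∀ {m} (f g : Fin m → ℤ) → ∑[ i < m ] (f i - g i) ≡ ∑[ i < m ] f i - ∑[ i < m ] g i
∑-distrib-- f g = trans (∑-distrib-+ f (-_ ∘ g)) (cong (_+_ (sum f)) ∑-neg)
  where
  ∑-neg : sum (-_ ∘ g) ≡ - sum g
  ∑-neg = trans (sum-cong-≗ (λ i → sym (ℤP.-1*i≡-i (g i))))
                (trans (sym (*-distribˡ-sum ℤ.-1ℤ g)) (ℤP.-1*i≡-i (sum g)))

∣0 : ∀ k → k ∣ℤ.∣ + 0
∣0 k = divides (+ 0) (sym (ℤP.*-zeroˡ k))

∣-unit : ∀ {k} u v a → v * u ≡ + 1 → k ∣ℤ.∣ u * a → k ∣ℤ.∣ a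
∣-unit {k} u v a vu≡1 k∣ua = subst (k ∣ℤ.∣_) v*ua≡a (∣ℤ.∣n⇒∣m*n v k∣ua)
  where
  v*ua≡a : v * (u * a) ≡ a
  v*ua≡a = trans (sym (ℤP.*-assoc v u a)) (trans (cong (_* a) vu≡1) (ℤP.*-identityˡ a))

∑-∣ : ∀ {m} k (f : Fin m → ℤ) → (∀ i → k ∣ℤ.∣ f i) → k ∣ℤ.∣ ∑[ i < m ] f i
∑-∣ {zero}  k f k∣f = ∣0 k
∑-∣ {suc m} k f k∣f = ∣ℤ.∣m∣n⇒∣m+n (k∣f zero) (∑-∣ k (f ∘ suc) (k∣f ∘ suc))

∑-∣-partner : ∀ {m} k (f : Fin m → ℤ) i → k ∣ℤ.∣ ∑[ j < m ] f j → ¬ k ∣ℤ.∣ f i →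
              ∃[ j ] (j ≢ i × ¬ k ∣ℤ.∣ f j)
∑-∣-partner {suc m} k f i k∣∑ k∤fᵢ
  with FinP.all? (λ j → k ∣ℤ.∣? f (punchIn i j))
... | yes k∣rest = ⊥-elim (k∤fᵢ (∣ℤ.∣m+n∣n⇒∣m (subst (k ∣ℤ.∣_) (sum-remove f) k∣∑) (∑-∣ k _ k∣rest)))
... | no ¬k∣rest with FinP.¬∀⟶∃¬ m _ (λ j → k ∣ℤ.∣? f (punchIn i j)) ¬k∣rest
...   | j , k∤fⱼ = punchIn i j , FinP.punchInᵢ≢i i j , k∤fⱼ

𝟙 : ∀ {P : Set} → Dec P → ℤ
𝟙 (yes _) = + 1
𝟙 (no _)  = + 0

if-≡𝟙* : ∀ {P : Set} (P? : Dec P) (a : ℤ) → (if does P? then a else + 0) ≡ 𝟙 P? * a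
if-≡𝟙* (yes _) a = sym (ℤP.*-identityˡ a)
if-≡𝟙* (no _)  a = sym (ℤP.*-zeroˡ a)

𝟙-yes : ∀ {P : Set} (P? : Dec P) → P → 𝟙 P? ≡ + 1
𝟙-yes (yes _) _ = refl
𝟙-yes (no ¬p) p = ⊥-elim (¬p p)

𝟙-no : ∀ {P : Set} (P? : Dec P) → ¬ P → 𝟙 P? ≡ + 0
𝟙-no (yes p) ¬p = ⊥-elim (¬p p)
𝟙-no (no _)  _  = refl

module NetFlow {n m : ℕ} (G : Graph n m) where

  -- incidence v e is +1 if e enters v, -1 if e leaves v, and 0 otherwise
  -- (in particular 0 for a loop at v).
  incidence : Fin n → Fin m → ℤ
  incidence v e = 𝟙 (tgt G e ≟ v) - 𝟙 (src G e ≟ v)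

  netFlow : Fin n → (Fin m → ℤ) → ℤ
  netFlow v x = ∑[ e < m ] (incidence v e * x e)

  inflow-outflow≡netFlow : ∀ (x : Fin m → ℤ) v →
    sumℤ (λ e → if does (tgt G e ≟ v) then x e else + 0)
      - sumℤ (λ e → if does (src G e ≟ v) then x e else + 0)
    ≡ netFlow v x
  inflow-outflow≡netFlow x v = begin
    sumℤ inflow - sumℤ outflow   ≡⟨ cong₂ _-_ (sumℤ≡∑ inflow) (sumℤ≡∑ outflow) ⟩
    sum inflow - sum outflow     ≡⟨ ∑-distrib-- inflow outflow ⟨
    sum (λ e → inflow e - outflow e)
      ≡⟨ sum-cong-≗ (λ e → trans (cong₂ _-_ (if-≡𝟙* (tgt G e ≟ v) (x e)) (if-≡𝟙* (src G e ≟ v) (x e)))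
                                 (sym (*-distribʳ-- (𝟙 (tgt G e ≟ v)) (𝟙 (src G e ≟ v)) (x e)))) ⟩
    netFlow v x                  ∎
    where
    open ≡-Reasoning
    *-distribʳ-- : ∀ a b c → (a - b) * c ≡ a * c - b * c
    *-distribʳ-- = solve-∀
    inflow outflow : Fin m → ℤ
    inflow  e = if does (tgt G e ≟ v) then x e else + 0
    outflow e = if does (src G e ≟ v) then x e else + 0

  flow⇒k∣netFlow : ∀ {k} φ → IsFlow G k φ → ∀ v → + k ∣ℤ.∣ netFlow v (val G φ)
  flow⇒k∣netFlow φ flow v = subst (_ ∣ℤ.∣_) (inflow-outflow≡netFlow (val G φ) v) (∣ℤ.∣ᵤ⇒∣ (flow v))

  k∣netFlow⇒flow : ∀ {k} φ → (∀ v → + k ∣ℤ.∣ netFlow v (val G φ)) → IsFlow G k φ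
  k∣netFlow⇒flow φ k∣ v = ∣ℤ.∣⇒∣ᵤ (subst (_ ∣ℤ.∣_) (sym (inflow-outflow≡netFlow (val G φ) v)) (k∣ v))

  netFlow-+ : ∀ v (x y : Fin m → ℤ) → netFlow v (λ e → x e + y e) ≡ netFlow v x + netFlow v y
  netFlow-+ v x y = trans (sum-cong-≗ (λ e → ℤP.*-distribˡ-+ (incidence v e) (x e) (y e)))
                          (∑-distrib-+ (λ e → incidence v e * x e) (λ e → incidence v e * y e))

  netFlow-- : ∀ v (x y : Fin m → ℤ) → netFlow v (λ e → x e - y e) ≡ netFlow v x - netFlow v y
  netFlow-- v x y = trans (sum-cong-≗ (λ e → *-distribˡ-- (incidence v e) (x e) (y e)))
                          (∑-distrib-- (λ e → incidence v e * x e) (λ e → incidence v e * y e))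
    where
    *-distribˡ-- : ∀ a b c → a * (b - c) ≡ a * b - a * c
    *-distribˡ-- = solve-∀

  netFlow-lincomb : ∀ {p} v (z : Fin p → ℤ) (X : Fin p → Fin m → ℤ) →
    netFlow v (λ e → ∑[ f < p ] (z f * X f e)) ≡ ∑[ f < p ] (z f * netFlow v (X f))
  netFlow-lincomb {p} v z X = begin
    ∑[ e < m ] (incidence v e * ∑[ f < p ] (z f * X f e))
      ≡⟨ sum-cong-≗ (λ e → *-distribˡ-sum (incidence v e) (λ f → z f * X f e)) ⟩
    ∑[ e < m ] ∑[ f < p ] (incidence v e * (z f * X f e))
      ≡⟨ sum-cong-≗ (λ e → sum-cong-≗ (λ f → swap (incidence v e) (z f) (X f e))) ⟩
    ∑[ e < m ] ∑[ f < p ] (z f * (incidence v e * X f e))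
      ≡⟨ ∑-comm (λ e f → z f * (incidence v e * X f e)) ⟩
    ∑[ f < p ] ∑[ e < m ] (z f * (incidence v e * X f e))
      ≡⟨ sum-cong-≗ (λ f → sym (*-distribˡ-sum (z f) (λ e → incidence v e * X f e))) ⟩
    ∑[ f < p ] (z f * netFlow v (X f)) ∎
    where
    open ≡-Reasoning
    swap : ∀ a b c → a * (b * c) ≡ b * (a * c)
    swap = solve-∀

  netFlow-congruent : ∀ {k} v (x y : Fin m → ℤ) → (∀ e → k ∣ℤ.∣ (x e - y e)) →
                      k ∣ℤ.∣ (netFlow v x - netFlow v y)
  netFlow-congruent {k} v x y k∣x-y =
    subst (k ∣ℤ.∣_) (netFlow-- v x y) (∑-∣ k _ (λ e → ∣ℤ.∣n⇒∣m*n (incidence v e) (k∣x-y e)))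

  sign : Dart m → ℤ
  sign (_ , true)  = + 1
  sign (_ , false) = ℤ.-1ℤ

  dartVector : Dart m → Fin m → ℤ
  dartVector d e = if does (proj₁ d ≟ e) then sign d else + 0

  walkVector : List (Dart m) → Fin m → ℤ
  walkVector []       e = + 0
  walkVector (d ∷ ds) e = dartVector d e + walkVector ds e

  incidence-sign : ∀ v d → incidence v (proj₁ d) * sign d ≡ 𝟙 (dend G d ≟ v) - 𝟙 (dstart G d ≟ v)
  incidence-sign v (e , true)  = ℤP.*-identityʳ _
  incidence-sign v (e , false) = reverse (𝟙 (tgt G e ≟ v)) (𝟙 (src G e ≟ v))
    where
    reverse : ∀ a b → (a - b) * ℤ.-1ℤ ≡ b - a
    reverse = solve-∀

  netFlow-dartVector : ∀ v d → netFlow v (dartVector d) ≡ 𝟙 (dend G d ≟ v) - 𝟙 (dstart G d ≟ v)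
  netFlow-dartVector v d = begin
    netFlow v (dartVector d)
      ≡⟨ ∑-single _ (proj₁ d) (λ e e≢ → trans (cong (incidence v e *_) (off e e≢)) (ℤP.*-zeroʳ (incidence v e))) ⟩
    incidence v (proj₁ d) * dartVector d (proj₁ d)
      ≡⟨ cong (λ b → incidence v (proj₁ d) * (if b then sign d else + 0)) (dec-true (proj₁ d ≟ proj₁ d) refl) ⟩
    incidence v (proj₁ d) * sign d
      ≡⟨ incidence-sign v d ⟩
    𝟙 (dend G d ≟ v) - 𝟙 (dstart G d ≟ v) ∎
    where
    open ≡-Reasoning
    off : ∀ e → e ≢ proj₁ d → dartVector d e ≡ + 0
    off e e≢ = cong (if_then sign d else + 0) (dec-false (proj₁ d ≟ e) (e≢ ∘ sym))

  -- Telescoping: the net flow of a walk's vector is +1 at its end and -1 at its start.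
  netFlow-walkVector : ∀ v a ds b → Chain G a ds b →
    netFlow v (walkVector ds) ≡ 𝟙 (b ≟ v) - 𝟙 (a ≟ v)
  netFlow-walkVector v a [] b refl = begin
    netFlow v (λ _ → + 0)     ≡⟨ ∑-zero _ (λ e → ℤP.*-zeroʳ (incidence v e)) ⟩
    + 0                       ≡⟨ ℤP.+-inverseʳ (𝟙 (a ≟ v)) ⟨
    𝟙 (a ≟ v) - 𝟙 (a ≟ v)     ∎
    where open ≡-Reasoning
  netFlow-walkVector v a (d ∷ ds) b (refl , chain) = begin
    netFlow v (walkVector (d ∷ ds))
      ≡⟨ netFlow-+ v (dartVector d) (walkVector ds) ⟩
    netFlow v (dartVector d) + netFlow v (walkVector ds)
      ≡⟨ cong₂ _+_ (netFlow-dartVector v d) (netFlow-walkVector v (dend G d) ds b chain) ⟩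
    (𝟙 (dend G d ≟ v) - 𝟙 (dstart G d ≟ v)) + (𝟙 (b ≟ v) - 𝟙 (dend G d ≟ v))
      ≡⟨ telescope (𝟙 (dend G d ≟ v)) (𝟙 (dstart G d ≟ v)) (𝟙 (b ≟ v)) ⟩
    𝟙 (b ≟ v) - 𝟙 (dstart G d ≟ v) ∎
    where
    open ≡-Reasoning
    telescope : ∀ x y z → (x - y) + (z - x) ≡ z - y
    telescope = solve-∀

  walkVector-absent : ∀ ds e → e ∉ₗ map proj₁ ds → walkVector ds e ≡ + 0
  walkVector-absent []       e e∉ = refl
  walkVector-absent (d ∷ ds) e e∉ =
    cong₂ _+_ (cong (if_then sign d else + 0) (dec-false (proj₁ d ≟ e) (e∉ ∘ here ∘ sym)))
              (walkVector-absent ds e (e∉ ∘ there))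

  walkVector-present : ∀ ds d → Unique (map proj₁ ds) → d ∈ₗ ds → walkVector ds (proj₁ d) ≡ sign d
  walkVector-present (d ∷ ds) .d (d∉ ∷ _) (here refl) =
    trans (cong₂ _+_ (cong (if_then sign d else + 0) (dec-true (proj₁ d ≟ proj₁ d) refl))
                     (walkVector-absent ds (proj₁ d) (λ d∈ → All.lookup d∉ d∈ refl)))
          (ℤP.+-identityʳ (sign d))
  walkVector-present (d ∷ ds) d′ (d∉ ∷ unique) (there d′∈) =
    trans (cong₂ _+_ (cong (if_then sign d else + 0) (dec-false (proj₁ d ≟ proj₁ d′) (All.lookup d∉ (∈-map⁺ proj₁ d′∈))))
                     (walkVector-present ds d′ unique d′∈))
          (ℤP.+-identityˡ (sign d′))

  signedCycle-circulation : ∀ (c : Fin m → ℤ) ds u → Chain G u ds u → Unique (map proj₁ ds) →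
    (∀ e → (e , true) ∈ₗ ds → c e ≡ + 1) →
    (∀ e → (e , false) ∈ₗ ds → c e ≡ ℤ.-1ℤ) →
    (∀ e → e ∉ₗ map proj₁ ds → c e ≡ + 0) →
    ∀ v → netFlow v c ≡ + 0
  signedCycle-circulation c ds u closed unique forward backward absent v = begin
    netFlow v c                 ≡⟨ sum-cong-≗ (λ e → cong (incidence v e *_) (c≗walkVector e)) ⟩
    netFlow v (walkVector ds)   ≡⟨ netFlow-walkVector v u ds u closed ⟩
    𝟙 (u ≟ v) - 𝟙 (u ≟ v)       ≡⟨ ℤP.+-inverseʳ (𝟙 (u ≟ v)) ⟩
    + 0                         ∎
    where
    open ≡-Reasoning
    open DecMembership (_≟_ {m}) using () renaming (_∈?_ to _∈ₗ?_)
    c≡sign : ∀ d → d ∈ₗ ds → c (proj₁ d) ≡ sign d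
    c≡sign (e , true)  = forward e
    c≡sign (e , false) = backward e
    c≗walkVector : ∀ e → c e ≡ walkVector ds e
    c≗walkVector e with e ∈ₗ? map proj₁ ds
    ... | no e∉ = trans (absent e e∉) (sym (walkVector-absent ds e e∉))
    ... | yes e∈ with ∈-map⁻ proj₁ e∈
    ...   | d , d∈ , refl = trans (c≡sign d d∈) (sym (walkVector-present ds d unique d∈))

AllIn-∈ : ∀ {n m} (G : Graph n m) (S : Fin m → Set) ds e → AllIn G S ds → e ∈ₗ map proj₁ ds → S e
AllIn-∈ G S (d ∷ ds) e (Sd , _)   (here refl) = Sd
AllIn-∈ G S (d ∷ ds) e (_ , Sds)  (there e∈) = AllIn-∈ G S ds e Sds e∈

module FundamentalCycles {n m : ℕ} (G : Graph n m) (T : Subset m) (C : Fin m → Fin m → ℤ)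
                         (fundamental : IsFundCycleMatrix G T C) where
  open NetFlow G

  row-circulation : ∀ f → f ∉ T → ∀ v → netFlow v (C f) ≡ + 0
  row-circulation f f∉T with fundamental f f∉T
  ... | ds , (_ , (u , closed) , _ , unique , _) , _ , forward , backward , absent =
    signedCycle-circulation (C f) ds u closed unique forward backward absent

  -- On T̄ × T̄ the matrix C is the identity: K_f meets T̄ only in f.
  C-diagonal : ∀ f → f ∉ T → C f f ≡ + 1
  C-diagonal f f∉T with fundamental f f∉T
  ... | _ , _ , f∈K , forward , _ = forward f f∈K

  C-offdiagonal : ∀ f g → f ∉ T → g ∉ T → g ≢ f → C f g ≡ + 0
  C-offdiagonal f g f∉T g∉T g≢f with fundamental f f∉T
  ... | ds , (_ , _ , inT∪f , _) , _ , _ , _ , absent = absent g (λ g∈ → not-in-T∪f (AllIn-∈ G _ ds g inT∪f g∈))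
    where
    not-in-T∪f : ¬ (g ∈ T ⊎ g ≡ f)
    not-in-T∪f (inj₁ g∈T) = g∉T g∈T
    not-in-T∪f (inj₂ g≡f) = g≢f g≡f

  cycleSum : (Fin m → ℤ) → Fin m → ℤ
  cycleSum z e = ∑[ f < m ] (z f * C f e)

  module _ (z : Fin m → ℤ) (z≡0-on-T : ∀ f → f ∈ T → z f ≡ + 0) where

    cycleSum-circulation : ∀ v → netFlow v (cycleSum z) ≡ + 0
    cycleSum-circulation v =
      trans (netFlow-lincomb v z C) (∑-zero _ term≡0)
      where
      term≡0 : ∀ f → z f * netFlow v (C f) ≡ + 0
      term≡0 f with f ∈? T
      ... | yes f∈T = trans (cong (_* netFlow v (C f)) (z≡0-on-T f f∈T)) (ℤP.*-zeroˡ (netFlow v (C f)))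
      ... | no  f∉T = trans (cong (z f *_) (row-circulation f f∉T v)) (ℤP.*-zeroʳ (z f))

    cycleSum-off-forest : ∀ f → f ∉ T → cycleSum z f ≡ z f
    cycleSum-off-forest f f∉T =
      trans (∑-single _ f term≡0) (trans (cong (z f *_) (C-diagonal f f∉T)) (ℤP.*-identityʳ (z f)))
      where
      term≡0 : ∀ g → g ≢ f → z g * C g f ≡ + 0
      term≡0 g g≢f with g ∈? T
      ... | yes g∈T = trans (cong (_* C g f) (z≡0-on-T g g∈T)) (ℤP.*-zeroˡ (C g f))
      ... | no  g∉T = trans (cong (z g *_) (C-offdiagonal g f g∉T f∉T (g≢f ∘ sym))) (ℤP.*-zeroʳ (z g))

Unique-++ˡ : ∀ {A : Set} (xs : List A) {ys} → Unique (xs ++ ys) → Unique xs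
Unique-++ˡ []       _              = []
Unique-++ˡ (x ∷ xs) (x∉ ∷ unique) = AllP.++⁻ˡ xs x∉ ∷ Unique-++ˡ xs unique

Unique-map-++ˡ : ∀ {A B : Set} (f : A → B) (xs : List A) {ys} → Unique (map f (xs ++ ys)) → Unique (map f xs)
Unique-map-++ˡ f xs {ys} unique = Unique-++ˡ (map f xs) (subst Unique (LP.map-++ f xs ys) unique)

Unique-length : ∀ {n} (xs : List (Fin n)) → Unique xs → length xs ℕ.≤ n
Unique-length {n} xs unique with length xs ℕ.≤? n
... | yes ≤n = ≤n
... | no  ≰n with FinP.pigeonhole (ℕP.≰⇒> ≰n) (List.lookup xs)
...   | i , j , i<j , same = ⊥-elim (distinct xs unique i j i<j same)
  where
  distinct : ∀ (xs : List (Fin n)) → Unique xs → ∀ i j → i Data.Fin.< j → List.lookup xs i ≢ List.lookup xs j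
  distinct (x ∷ xs) (x∉ ∷ _)      zero    (suc j) _   = All.lookup x∉ (∈-lookup j)
  distinct (x ∷ xs) (_ ∷ unique)  (suc i) (suc j) i<j = distinct xs unique i j (ℕP.≤-pred i<j)

∈-insert : ∀ {A : Set} {x y z : A} {xs} → z ∈ₗ (x ∷ xs) → z ∈ₗ (x ∷ y ∷ xs)
∈-insert (here z≡x)  = here z≡x
∈-insert (there z∈) = there (there z∈)

∉-insert : ∀ {A : Set} {x y : A} {xs} → Unique (x ∷ y ∷ xs) → y ∉ₗ (x ∷ xs)
∉-insert ((x≢y ∷ _) ∷ _) (here y≡x) = x≢y (sym y≡x)
∉-insert (_ ∷ (y∉ ∷ _)) (there y∈) = All.lookup y∉ y∈ refl

Unique-insert : ∀ {A : Set} {x y : A} {xs} → Unique (x ∷ xs) → y ∉ₗ (x ∷ xs) → Unique (x ∷ y ∷ xs)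
Unique-insert (x∉ ∷ unique) y∉ = ((λ x≡y → y∉ (here (sym x≡y))) ∷ x∉) ∷ AllP.¬Any⇒All¬ _ (y∉ ∘ there) ∷ unique

module Walks {n m : ℕ} (G : Graph n m) where

  visited : List (Dart m) → Fin n → List (Fin n)
  visited ds b = b ∷ map (dstart G) ds

  same-edge : ∀ d d′ → proj₁ d′ ≡ proj₁ d → dstart G d′ ≡ dstart G d ⊎ dstart G d′ ≡ dend G d
  same-edge (e , true)  (.e , true)  refl = inj₁ refl
  same-edge (e , true)  (.e , false) refl = inj₂ refl
  same-edge (e , false) (.e , true)  refl = inj₂ refl
  same-edge (e , false) (.e , false) refl = inj₁ refl

  chain-start : ∀ {a b} ds → Chain G a ds b → a ∈ₗ visited ds b
  chain-start []       a≡b          = here a≡b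
  chain-start (d ∷ ds) (start≡a , _) = there (here (sym start≡a))

  chain-dend : ∀ {a b} ds d → Chain G a ds b → d ∈ₗ ds → dend G d ∈ₗ visited ds b
  chain-dend (d ∷ ds) .d  (_ , chain) (here refl) = ∈-insert (chain-start ds chain)
  chain-dend (d ∷ ds) d′ (_ , chain) (there d′∈) = ∈-insert (chain-dend ds d′ chain d′∈)

  split : ∀ {a b} x ds → Chain G a ds b → x ∈ₗ visited ds b →
    ∃₂ λ pre post → pre ++ post ≡ ds × Chain G a pre x × x ∉ₗ map (dstart G) pre
  split x []       a≡b (here x≡b) = [] , [] , refl , trans a≡b (sym x≡b) , λ ()
  split x (d ∷ ds) (start≡a , chain) x∈ with x ≟ dstart G d
  ... | yes x≡start = [] , d ∷ ds , refl , trans (sym start≡a) (sym x≡start) , λ ()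
  ... | no  x≢start with split x ds chain (skip x∈)
    where
    skip : x ∈ₗ (_ ∷ dstart G d ∷ map (dstart G) ds) → x ∈ₗ visited ds _
    skip (here x≡b)          = here x≡b
    skip (there (here x≡s))  = ⊥-elim (x≢start x≡s)
    skip (there (there x∈))  = there x∈
  ...   | pre , post , pre++post≡ds , chain′ , x∉ =
    d ∷ pre , post , cong (d ∷_) pre++post≡ds , (start≡a , chain′) ,
    λ { (here x≡start) → x≢start x≡start ; (there x∈′) → x∉ x∈′ }

  path-edges-unique : ∀ {a b} ds → Chain G a ds b → Unique (visited ds b) → Unique (map proj₁ ds)
  path-edges-unique []       _             _      = []
  path-edges-unique (d ∷ ds) (_ , chain) unique =
    All.tabulate edge-new ∷ path-edges-unique ds chain (drop-second unique)
    where
    drop-second : ∀ {x y : Fin n} {xs} → Unique (x ∷ y ∷ xs) → Unique (x ∷ xs)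
    drop-second ((_ ∷ x∉) ∷ _ ∷ unique) = x∉ ∷ unique
    -- dstart d is not visited by the rest of the walk, but both ends of d′ are
    edge-new : ∀ {e} → e ∈ₗ map proj₁ ds → proj₁ d ≢ e
    edge-new e∈ e≡ with ∈-map⁻ proj₁ e∈
    ... | d′ , d′∈ , refl with same-edge d′ d e≡
    ...   | inj₁ same = ∉-insert unique (subst (_∈ₗ _) (sym same) (there (∈-map⁺ (dstart G) d′∈)))
    ...   | inj₂ same = ∉-insert unique (subst (_∈ₗ _) (sym same) (chain-dend ds d′ chain d′∈))

  AllIn-++ˡ : ∀ (S : Fin m → Set) xs {ys} → AllIn G S (xs ++ ys) → AllIn G S xs
  AllIn-++ˡ S []       _          = tt
  AllIn-++ˡ S (d ∷ ds) (Sd , Sds) = Sd , AllIn-++ˡ S ds Sds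

  AllIn-mono : ∀ {S S′ : Fin m → Set} → (∀ e → S e → S′ e) → ∀ ds → AllIn G S ds → AllIn G S′ ds
  AllIn-mono S⊆S′ []       _          = tt
  AllIn-mono S⊆S′ (d ∷ ds) (Sd , Sds) = S⊆S′ _ Sd , AllIn-mono S⊆S′ ds Sds

-- The forest lemma: if k divides the net flow of ψ at every vertex and
-- divides ψ off a forest T, then k divides ψ on every edge.  Otherwise the
-- edges S where k ∤ ψ lie in T, and at each end of an S-edge another S-edge
-- arrives; following them backwards yields ever longer paths in S, until a
-- vertex repeats and closes a cycle in T.
module ForestLemma {n m : ℕ} (G : Graph n m) (T : Subset m) (forest : IsForest G T)
                   (k : ℤ) (ψ : Fin m → ℤ)
                   (balanced : ∀ v → k ∣ℤ.∣ NetFlow.netFlow G v ψ)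
                   (k∣off-T : ∀ e → e ∉ T → k ∣ℤ.∣ ψ e) where
  open NetFlow G
  open Walks G

  S : Fin m → Set
  S e = ¬ k ∣ℤ.∣ ψ e

  S⊆T : ∀ e → S e → e ∈ T
  S⊆T e Se with e ∈? T
  ... | yes e∈T = e∈T
  ... | no  e∉T = ⊥-elim (Se (k∣off-T e e∉T))

  dart-into : ∀ x j → incidence x j ≢ + 0 → ∃[ d ] (proj₁ d ≡ j × dend G d ≡ x)
  dart-into x j = by-cases (tgt G j ≟ x) (src G j ≟ x)
    where
    by-cases : (t : Dec (tgt G j ≡ x)) (s : Dec (src G j ≡ x)) → 𝟙 t - 𝟙 s ≢ + 0 →
               ∃[ d ] (proj₁ d ≡ j × dend G d ≡ x)
    by-cases (yes tgt≡x) _          _       = (j , true) , refl , tgt≡x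
    by-cases (no _)      (yes src≡x) _       = (j , false) , refl , src≡x
    by-cases (no _)      (no _)      nonzero = ⊥-elim (nonzero refl)

  incident-S-edge : ∀ x j → ¬ k ∣ℤ.∣ incidence x j * ψ j → ∃[ d ] (proj₁ d ≡ j × dend G d ≡ x × S j)
  incident-S-edge x j k∤term with dart-into x j incidence≢0
    where
    incidence≢0 : incidence x j ≢ + 0
    incidence≢0 incidence≡0 = k∤term (∣ℤ.∣m⇒∣m*n (ψ j) (subst (k ∣ℤ.∣_) (sym incidence≡0) (∣0 k)))
  ... | d , d-on-j , d→x = d , d-on-j , d→x , λ k∣ψⱼ → k∤term (∣ℤ.∣n⇒∣m*n (incidence x j) k∣ψⱼ)

  start-term : ∀ h → dstart G h ≢ dend G h →
    k ∣ℤ.∣ incidence (dstart G h) (proj₁ h) * ψ (proj₁ h) → k ∣ℤ.∣ ψ (proj₁ h)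
  start-term h ¬loop = ∣-unit (incidence x (proj₁ h)) (- sign h) (ψ (proj₁ h)) inverse
    where
    x : Fin n
    x = dstart G h
    incidence*sign≡-1 : incidence x (proj₁ h) * sign h ≡ ℤ.-1ℤ
    incidence*sign≡-1 = trans (incidence-sign x h)
      (cong₂ _-_ (𝟙-no (dend G h ≟ x) (¬loop ∘ sym)) (𝟙-yes (dstart G h ≟ x) refl))
    inverse : - sign h * incidence x (proj₁ h) ≡ + 1
    inverse = trans (sym (ℤP.neg-distribˡ-* (sign h) _))
                    (cong -_ (trans (ℤP.*-comm (sign h) _) incidence*sign≡-1))

  -- Since k divides the net flow at the start of a non-loop S-dart h, some
  -- other S-edge arrives there.
  continue : ∀ h → S (proj₁ h) → dstart G h ≢ dend G h →
             ∃[ d ] (dend G d ≡ dstart G h × S (proj₁ d) × proj₁ d ≢ proj₁ h)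
  continue h Sh ¬loop
    with ∑-∣-partner k (λ e → incidence (dstart G h) e * ψ e) (proj₁ h)
                     (balanced (dstart G h)) (Sh ∘ start-term h ¬loop)
  ... | j , j≢h , k∤term with incident-S-edge (dstart G h) j k∤term
  ...   | d , refl , d→x , Sd = d , d→x , Sd , j≢h

  record Path : Set where
    field
      first  : Dart m
      rest   : List (Dart m)
      end    : Fin n
      chain  : Chain G (dstart G first) (first ∷ rest) end
      inS    : AllIn G S (first ∷ rest)
      simple : Unique (visited (first ∷ rest) end)

  module _ (P : Path) where
    open Path P

    first-not-loop : dstart G first ≢ dend G first
    first-not-loop start≡end =
      ∉-insert simple (subst (_∈ₗ visited rest end) (sym start≡end) (chain-start rest (proj₂ chain)))

    -- An S-edge d arriving at the start of the path from an already visited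
    -- vertex closes a cycle in T, which is impossible.
    no-closing-edge : ∀ d → dend G d ≡ dstart G first → S (proj₁ d) → proj₁ d ≢ proj₁ first →
                      dstart G d ∉ₗ visited (first ∷ rest) end
    no-closing-edge d d→first Sd d≢first visited-before
      with split (dstart G d) (first ∷ rest) chain visited-before
    ... | pre , post , pre++post≡path , chain-pre , w∉pre = forest (d ∷ pre) cycle
      where
      w : Fin n
      w = dstart G d
      pre⊆path : ∀ {d′} → d′ ∈ₗ pre → d′ ∈ₗ first ∷ rest
      pre⊆path d′∈ = subst (_ ∈ₗ_) pre++post≡path (∈-++⁺ˡ d′∈)
      pre-simple : Unique (visited pre w)
      pre-simple = AllP.¬Any⇒All¬ _ w∉pre ∷ Unique-map-++ˡ (dstart G) pre starts-unique
        where
        drop-end : ∀ {x : Fin n} {xs} → Unique (x ∷ xs) → Unique xs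
        drop-end (_ ∷ unique) = unique
        starts-unique : Unique (map (dstart G) (pre ++ post))
        starts-unique = subst (Unique ∘ map (dstart G)) (sym pre++post≡path) (drop-end simple)
      -- d's edge is not on pre: a dart of pre on it would start at w (not
      -- visited by pre) or at the start of the path (so it would be `first`)
      d-new : ∀ {e} → e ∈ₗ map proj₁ pre → proj₁ d ≢ e
      d-new e∈ d≡e with ∈-map⁻ proj₁ e∈
      ... | d′ , d′∈ , refl with same-edge d d′ (sym d≡e) | pre⊆path d′∈
      ...   | inj₁ at-w     | _          = w∉pre (subst (_∈ₗ _) at-w (∈-map⁺ (dstart G) d′∈))
      ...   | inj₂ _        | here refl  = d≢first d≡e
      ...   | inj₂ at-first | there d′∈rest =
        ∉-insert simple (there (subst (_∈ₗ _) (trans at-first d→first) (∈-map⁺ (dstart G) d′∈rest)))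
      cycle : IsCycle G (_∈ T) (d ∷ pre)
      cycle = (λ ())
            , (w , refl , subst (λ x → Chain G x pre w) (sym d→first) chain-pre)
            , (S⊆T _ Sd , AllIn-mono S⊆T pre (AllIn-++ˡ S pre (subst (AllIn G S) (sym pre++post≡path) inS)))
            , (All.tabulate d-new ∷ path-edges-unique pre chain-pre pre-simple)
            , pre-simple

    grow : Σ Path (λ P′ → length (Path.rest P′) ≡ suc (length rest))
    grow with continue first (proj₁ inS) first-not-loop
    ... | d , d→first , Sd , d≢first = extended , refl
      where
      extended : Path
      extended = record
        { first  = d
        ; rest   = first ∷ rest
        ; end    = end
        ; chain  = refl , subst (λ x → Chain G x (first ∷ rest) end) (sym d→first) chain
        ; inS    = Sd , inS
        ; simple = Unique-insert simple (no-closing-edge d d→first Sd d≢first)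
        }

  long-path : ∀ e → S e → src G e ≢ tgt G e → ∀ l → Σ Path (λ P → length (Path.rest P) ≡ l)
  long-path e Se ¬loop zero = initial , refl
    where
    initial : Path
    initial = record
      { first = e , true ; rest = [] ; end = tgt G e ; chain = refl , refl ; inS = Se , tt
      ; simple = ((λ tgt≡src → ¬loop (sym tgt≡src)) ∷ []) ∷ [] ∷ [] }
  long-path e Se ¬loop (suc l) with long-path e Se ¬loop l
  ... | P , refl = grow P

  -- A path visits 2 + length rest distinct vertices, so length rest < n.
  short : (P : Path) → n ℕ.≤ length (Path.rest P) → ⊥
  short P n≤len = ℕP.n≮n n (ℕP.≤-trans (ℕP.n≤1+n (suc n)) (ℕP.≤-trans (ℕP.+-monoʳ-≤ 2 n≤len) bound))
    where
    open Path P
    bound : 2 ℕ.+ length rest ℕ.≤ n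
    bound = subst (λ len → 2 ℕ.+ len ℕ.≤ n) (LP.length-map (dstart G) rest)
                  (Unique-length (visited (first ∷ rest) end) simple)

  -- An S-loop is a cycle in T; from any other S-edge, paths of length n are impossible.
  forest-lemma : ∀ e → k ∣ℤ.∣ ψ e
  forest-lemma e with k ∣ℤ.∣? ψ e
  ... | yes k∣ψₑ = k∣ψₑ
  ... | no  Se with src G e ≟ tgt G e
  ...   | yes loop = ⊥-elim (forest ((e , true) ∷ [])
                      ((λ ()) , (src G e , refl , sym loop) , (S⊆T e Se , tt) , [] ∷ [] , [] ∷ []))
  ...   | no ¬loop with long-path e Se ¬loop n
  ...     | P , len≡n = ⊥-elim (short P (ℕP.≤-reflexive (sym len≡n)))

sumℚ-cong : ∀ {p} {f g : Fin p → ℚ} → (∀ i → f i ≡ g i) → sumℚ f ≡ sumℚ g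
sumℚ-cong {zero}  f≗g = refl
sumℚ-cong {suc p} f≗g = cong₂ ℚ._+_ (f≗g zero) (sumℚ-cong (f≗g ∘ suc))

-- Rationals with denominator k = suc k'.  Each statement is checked in the
-- unnormalised rationals, where a / k is literally the fraction mkℚᵘ a k'.
module Scaled (k' : ℕ) where
  open ℚᵘP.≃-Reasoning

  k : ℕ
  k = suc k'

  K : ℤ
  K = + k

  toℚᵘ-/ : ∀ a j → toℚᵘ (a ℚ./ suc j) ≃ mkℚᵘ a j
  toℚᵘ-/ a j = ℚP.toℚᵘ-fromℚᵘ (mkℚᵘ a j)

  /k-+ : ∀ a b → (a ℚ./ k) ℚ.+ (b ℚ./ k) ≡ (a + b) ℚ./ k
  /k-+ a b = ℚP.toℚᵘ-injective (begin
    toℚᵘ ((a ℚ./ k) ℚ.+ (b ℚ./ k))          ≈⟨ ℚP.toℚᵘ-homo-+ (a ℚ./ k) (b ℚ./ k) ⟩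
    toℚᵘ (a ℚ./ k) ℚᵘ.+ toℚᵘ (b ℚ./ k)      ≈⟨ ℚᵘP.+-cong (toℚᵘ-/ a k') (toℚᵘ-/ b k') ⟩
    mkℚᵘ a k' ℚᵘ.+ mkℚᵘ b k'                ≈⟨ *≡* (trans (collect a b K) (cong ((a + b) *_) (sym (ℤP.pos-* k k)))) ⟩
    mkℚᵘ (a + b) k'                         ≈⟨ ℚᵘP.≃-sym (toℚᵘ-/ (a + b) k') ⟩
    toℚᵘ ((a + b) ℚ./ k)                    ∎)
    where
    collect : ∀ a b K → (a * K + b * K) * K ≡ (a + b) * (K * K)
    collect = solve-∀

  /1*/k : ∀ c a → (c ℚ./ 1) ℚ.* (a ℚ./ k) ≡ (c * a) ℚ./ k
  /1*/k c a = ℚP.toℚᵘ-injective (begin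
    toℚᵘ ((c ℚ./ 1) ℚ.* (a ℚ./ k))          ≈⟨ ℚP.toℚᵘ-homo-* (c ℚ./ 1) (a ℚ./ k) ⟩
    toℚᵘ (c ℚ./ 1) ℚᵘ.* toℚᵘ (a ℚ./ k)      ≈⟨ ℚᵘP.*-cong (toℚᵘ-/ c 0) (toℚᵘ-/ a k') ⟩
    mkℚᵘ c 0 ℚᵘ.* mkℚᵘ a k'                 ≈⟨ *≡* (cong ((c * a) *_) (cong +_ (sym (ℕP.*-identityˡ k)))) ⟩
    mkℚᵘ (c * a) k'                         ≈⟨ ℚᵘP.≃-sym (toℚᵘ-/ (c * a) k') ⟩
    toℚᵘ ((c * a) ℚ./ k)                    ∎)

  /k≡/1⇒ : ∀ a d → a ℚ./ k ≡ d ℚ./ 1 → a ≡ d * K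
  /k≡/1⇒ a d a/k≡d with ℚᵘP.≃-trans (ℚᵘP.≃-sym (toℚᵘ-/ a k')) (ℚᵘP.≃-trans (ℚP.toℚᵘ-cong a/k≡d) (toℚᵘ-/ d 0))
  ... | *≡* a*1≡d*K = trans (sym (ℤP.*-identityʳ a)) a*1≡d*K

  /k≡/1⇐ : ∀ a d → a ≡ d * K → a ℚ./ k ≡ d ℚ./ 1
  /k≡/1⇐ a d a≡dK = ℚP.toℚᵘ-injective (begin
    toℚᵘ (a ℚ./ k)   ≈⟨ toℚᵘ-/ a k' ⟩
    mkℚᵘ a k'        ≈⟨ *≡* (trans (ℤP.*-identityʳ a) a≡dK) ⟩
    mkℚᵘ d 0         ≈⟨ ℚᵘP.≃-sym (toℚᵘ-/ d 0) ⟩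
    toℚᵘ (d ℚ./ 1)   ∎)

  0</k⇒ : ∀ a → 0ℚ ℚ.< a ℚ./ k → + 0 ℤ.< a
  0</k⇒ a 0<a/k with ℚᵘP.<-respʳ-≃ (toℚᵘ-/ a k') (ℚP.toℚᵘ-mono-< 0<a/k)
  ... | *<* 0*K<a*1 = subst₂ ℤ._<_ (ℤP.*-zeroˡ K) (ℤP.*-identityʳ a) 0*K<a*1

  0</k⇐ : ∀ a → + 0 ℤ.< a → 0ℚ ℚ.< a ℚ./ k
  0</k⇐ a 0<a = ℚP.toℚᵘ-cancel-< (ℚᵘP.<-respʳ-≃ (ℚᵘP.≃-sym (toℚᵘ-/ a k'))
    (*<* (subst₂ ℤ._<_ (sym (ℤP.*-zeroˡ K)) (sym (ℤP.*-identityʳ a)) 0<a)))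

  /k<1⇒ : ∀ a → a ℚ./ k ℚ.< 1ℚ → a ℤ.< K
  /k<1⇒ a a/k<1 with ℚᵘP.<-respˡ-≃ (toℚᵘ-/ a k') (ℚP.toℚᵘ-mono-< a/k<1)
  ... | *<* a*1<1*K = subst₂ ℤ._<_ (ℤP.*-identityʳ a) (ℤP.*-identityˡ K) a*1<1*K

  /k<1⇐ : ∀ a → a ℤ.< K → a ℚ./ k ℚ.< 1ℚ
  /k<1⇐ a a<K = ℚP.toℚᵘ-cancel-< (ℚᵘP.<-respˡ-≃ (ℚᵘP.≃-sym (toℚᵘ-/ a k'))
    (*<* (subst₂ ℤ._<_ (sym (ℤP.*-identityʳ a)) (sym (ℤP.*-identityˡ K)) a<K)))

  sumℚ-/k : ∀ {p} (x : Fin p → ℤ) → sumℚ (λ f → x f ℚ./ k) ≡ sumℤ x ℚ./ k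
  sumℚ-/k {zero}  x = sym (ℚP.0/n≡0 k)
  sumℚ-/k {suc p} x = trans (cong (ℚ._+_ (x zero ℚ./ k)) (sumℚ-/k (x ∘ suc))) (/k-+ (x zero) _)

Unique-map-on : ∀ {A B : Set} (P : A → Set) (f : A → B) →
  (∀ {x y} → P x → P y → f x ≡ f y → x ≡ y) → ∀ xs → All P xs → Unique xs → Unique (map f xs)
Unique-map-on P f injective []       _          _              = []
Unique-map-on P f injective (x ∷ xs) (Px ∷ Pxs) (x∉ ∷ unique) =
  All.tabulate (λ fy∈ fx≡fy → new fy∈ fx≡fy) ∷ Unique-map-on P f injective xs Pxs unique
  where
  new : ∀ {b} → b ∈ₗ map f xs → f x ≢ b
  new fy∈ fx≡fy with ∈-map⁻ f fy∈
  ... | y , y∈ , refl = All.lookup x∉ y∈ (injective Px (All.lookup Pxs y∈) fx≡fy)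

HasSize-transport : ∀ {A B : Set} {P : A → Set} {Q : B → Set} {N} (f : A → B) (g : B → A) →
  (∀ a → P a → Q (f a)) → (∀ b → Q b → P (g b)) →
  (∀ a → P a → g (f a) ≡ a) → (∀ b → Q b → f (g b) ≡ b) →
  HasSize P N → HasSize Q N
HasSize-transport {P = P} {Q} f g P⇒Q Q⇒P g∘f f∘g (xs , unique , length≡N , P⇔∈) =
  map f xs ,
  Unique-map-on P f (λ {a} {a′} Pa Pa′ fa≡fa′ → trans (sym (g∘f a Pa)) (trans (cong g fa≡fa′) (g∘f a′ Pa′)))
                xs (All.tabulate (Equivalence.from (P⇔∈ _))) unique ,
  trans (LP.length-map f xs) length≡N ,
  λ b → mk⇔ (λ Qb → subst (_∈ₗ map f xs) (f∘g b Qb) (∈-map⁺ f (Equivalence.to (P⇔∈ (g b)) (Q⇒P b Qb))))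
             (λ b∈ → Q-image b∈)
  where
  Q-image : ∀ {b} → b ∈ₗ map f xs → Q b
  Q-image b∈ with ∈-map⁻ f b∈
  ... | a , a∈ , refl = P⇒Q a (Equivalence.from (P⇔∈ a) a∈)

allVectors : ∀ k p → List (Vec (Fin k) p)
allVectors k zero    = [] ∷ []
allVectors k (suc p) = List.cartesianProductWith _∷_ (List.allFin k) (allVectors k p)

allVectors-unique : ∀ k p → Unique (allVectors k p)
allVectors-unique k zero    = [] ∷ []
allVectors-unique k (suc p) =
  UP.cartesianProductWith⁺ _∷_ VecP.∷-injective (UP.allFin⁺ k) (allVectors-unique k p)

allVectors-complete : ∀ {k p} (v : Vec (Fin k) p) → v ∈ₗ allVectors k p
allVectors-complete []      = here refl
allVectors-complete (x ∷ v) = ∈-cartesianProductWith⁺ _∷_ (∈-allFin x) (allVectors-complete v)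

HasSize-decidable : ∀ {k p} {P : Vec (Fin k) p → Set} → (∀ v → Dec (P v)) → ∃[ N ] HasSize P N
HasSize-decidable {k} {p} P? =
  length selected ,
  selected , UP.filter⁺ P? (allVectors-unique k p) , refl ,
  λ v → mk⇔ (∈-filter⁺ P? (allVectors-complete v)) (proj₂ ∘ ∈-filter⁻ P? {xs = allVectors k p})
  where
  selected : List (Vec (Fin k) p)
  selected = List.filter P? (allVectors k p)

Vec-ext : ∀ {A : Set} {p} (u w : Vec A p) → (∀ i → lookup u i ≡ lookup w i) → u ≡ w
Vec-ext u w u≗w =
  trans (sym (VecP.tabulate∘lookup u)) (trans (VecP.tabulate-cong u≗w) (VecP.tabulate∘lookup w))

module Residues (k' : ℕ) where
  open Scaled k' using (k; K)

  multiple<k⇒0 : ∀ d → d ℕ.< k → k ℕD.∣ d → d ≡ 0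
  multiple<k⇒0 d d<k k∣d = trans (sym (ℕDM.m<n⇒m%n≡m d<k)) (ℕD.n∣m⇒m%n≡0 d k k∣d)

  residue-unique-≤ : ∀ r s → r ℕ.< k → s ℕ.≤ r → K ∣ℤ.∣ (+ r - + s) → r ≡ s
  residue-unique-≤ r s r<k s≤r K∣r-s = ℕP.≤-antisym (ℕP.m∸n≡0⇒m≤n r∸s≡0) s≤r
    where
    r∸s≡0 : r ℕ.∸ s ≡ 0
    r∸s≡0 = multiple<k⇒0 (r ℕ.∸ s) (ℕP.≤-<-trans (ℕP.m∸n≤m r s) r<k)
      (∣ℤ.∣⇒∣ᵤ (subst (K ∣ℤ.∣_) (trans (ℤP.m-n≡m⊖n r s) (ℤP.⊖-≥ s≤r)) K∣r-s))

  residue-unique : ∀ r s → r ℕ.< k → s ℕ.< k → K ∣ℤ.∣ (+ r - + s) → r ≡ s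
  residue-unique r s r<k s<k K∣r-s with ℕP.≤-total s r
  ... | inj₁ s≤r = residue-unique-≤ r s r<k s≤r K∣r-s
  ... | inj₂ r≤s = sym (residue-unique-≤ s r s<k r≤s (subst (K ∣ℤ.∣_) (swap (+ r) (+ s)) (∣ℤ.∣m⇒∣-m K∣r-s)))
    where
    swap : ∀ a b → - (a - b) ≡ b - a
    swap = solve-∀

  residue-congruent : ∀ a → K ∣ℤ.∣ (+ (a ℤ.%ℕ k) - a)
  residue-congruent a =
    divides (- (a ℤ./ℕ k)) (trans (cong (λ x → + (a ℤ.%ℕ k) - x) (ℤDM.a≡a%ℕn+[a/ℕn]*n a k))
                                  (cancel (+ (a ℤ.%ℕ k)) (a ℤ./ℕ k) K))
    where
    cancel : ∀ r q K → r - (r + q * K) ≡ (- q) * K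
    cancel = solve-∀

  residue≡0⇒∣ : ∀ a → a ℤ.%ℕ k ≡ 0 → K ∣ℤ.∣ a
  residue≡0⇒∣ a residue≡0 =
    subst (K ∣ℤ.∣_) (trans (cong -_ (ℤP.+-identityˡ (- a))) (ℤP.neg-involutive a))
          (∣ℤ.∣m⇒∣-m (subst (λ r → K ∣ℤ.∣ (+ r - a)) residue≡0 (residue-congruent a)))

  ∣⇒residue≡0 : ∀ a → K ∣ℤ.∣ a → a ℤ.%ℕ k ≡ 0
  ∣⇒residue≡0 a K∣a = multiple<k⇒0 (a ℤ.%ℕ k) (ℤDM.n%ℕd<d a k)
    (∣ℤ.∣⇒∣ᵤ (subst (K ∣ℤ.∣_) (add-back (+ (a ℤ.%ℕ k)) a) (∣ℤ.∣m∣n⇒∣m+n (residue-congruent a) K∣a)))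
    where
    add-back : ∀ r a → (r - a) + a ≡ r
    add-back = solve-∀

module Correspondence {n m : ℕ} (G : Graph n m) (T : Subset m) (C : Fin m → Fin m → ℤ)
                      (fundamental : IsFundCycleMatrix G T C) (forest : IsForest G T) (k' : ℕ) where
  open NetFlow G
  open FundamentalCycles G T C fundamental
  open Scaled k'
  open Residues k'

  restrict : Vec (Fin k) m → Vec ℤ m
  restrict φ = tabulate (λ e → if does (e ∈? T) then + 0 else val G φ e)

  reduce : Vec ℤ m → Vec (Fin k) m
  reduce z = tabulate (λ e → fromℕ< (ℤDM.n%ℕd<d (cycleSum (lookup z) e) k))

  restrict-on-T : ∀ φ e → e ∈ T → lookup (restrict φ) e ≡ + 0
  restrict-on-T φ e e∈T = trans (VecP.lookup∘tabulate _ e)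
    (cong (if_then + 0 else val G φ e) (dec-true (e ∈? T) e∈T))

  restrict-off-T : ∀ φ e → e ∉ T → lookup (restrict φ) e ≡ val G φ e
  restrict-off-T φ e e∉T = trans (VecP.lookup∘tabulate _ e)
    (cong (if_then + 0 else val G φ e) (dec-false (e ∈? T) e∉T))

  toℕ-reduce : ∀ z e → toℕ (lookup (reduce z) e) ≡ cycleSum (lookup z) e ℤ.%ℕ k
  toℕ-reduce z e = trans (cong toℕ (VecP.lookup∘tabulate _ e)) (FinP.toℕ-fromℕ< _)

  hyperplane-value : ∀ (z : Fin m → ℤ) → (∀ f → f ∈ T → z f ≡ + 0) → ∀ e →
    sumT̄ T (λ f → (C f e ℚ./ 1) ℚ.* (z f ℚ./ k)) ≡ cycleSum z e ℚ./ k
  hyperplane-value z z≡0-on-T e =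
    trans (sumℚ-cong term) (trans (sumℚ-/k (λ f → z f * C f e)) (cong (ℚ._/ k) (sumℤ≡∑ (λ f → z f * C f e))))
    where
    term : ∀ f → (if does (f ∈? T) then 0ℚ else (C f e ℚ./ 1) ℚ.* (z f ℚ./ k)) ≡ (z f * C f e) ℚ./ k
    term f with f ∈? T
    ... | yes f∈T = sym (trans (cong (λ x → (x * C f e) ℚ./ k) (z≡0-on-T f f∈T)) (ℚP.0/n≡0 k))
    ... | no  _   = trans (/1*/k (C f e) (z f)) (cong (ℚ._/ k) (ℤP.*-comm (C f e) (z f)))

  on-hyperplane⇒∣ : ∀ z → (∀ f → f ∈ T → z f ≡ + 0) → ∀ e d →
    OnHyperplane T C e d (λ f → z f ℚ./ k) → K ∣ℤ.∣ cycleSum z e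
  on-hyperplane⇒∣ z z≡0-on-T e d on-H =
    divides d (/k≡/1⇒ (cycleSum z e) d (trans (sym (hyperplane-value z z≡0-on-T e)) on-H))

  value-in-range : ∀ a → + 0 ℤ.< a → a ℤ.< K → ∃[ r ] (a ≡ + r × 0 ℕ.< r × r ℕ.< k)
  value-in-range (+ r) (ℤ.+<+ 0<r) (ℤ.+<+ r<k) = r , refl , 0<r , r<k

  lattice-value : ∀ z → LatticePoint T C k z → ∀ e → e ∉ T →
    ∃[ r ] (lookup z e ≡ + r × 0 ℕ.< r × r ℕ.< k × cycleSum (lookup z) e ℤ.%ℕ k ≡ r)
  lattice-value z (z≡0-on-T , in-cube , _) e e∉T
    with value-in-range (lookup z e) (0</k⇒ _ (proj₁ (in-cube e e∉T))) (/k<1⇒ _ (proj₂ (in-cube e e∉T)))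
  ... | r , z≡r , 0<r , r<k = r , z≡r , 0<r , r<k ,
    trans (cong (ℤ._%ℕ k) (trans (cycleSum-off-forest (lookup z) z≡0-on-T e e∉T) z≡r)) (ℕDM.m<n⇒m%n≡m r<k)

  -- The heart of the argument: by the forest lemma, a ℤ_k-flow is the
  -- reduction of the circulation built from its own values off T.
  flow-congruent : ∀ φ → IsFlow G k φ → ∀ e → K ∣ℤ.∣ (val G φ e - cycleSum (lookup (restrict φ)) e)
  flow-congruent φ flow = ForestLemma.forest-lemma G T forest K ψ balanced vanishes-off-T
    where
    y ψ : Fin m → ℤ
    y = cycleSum (lookup (restrict φ))
    ψ e = val G φ e - y e
    balanced : ∀ v → K ∣ℤ.∣ netFlow v ψ
    balanced v = subst (K ∣ℤ.∣_) (sym (netFlow-- v (val G φ) y))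
      (∣ℤ.∣m∣n⇒∣m-n (flow⇒k∣netFlow φ flow v)
        (subst (K ∣ℤ.∣_) (sym (cycleSum-circulation _ (restrict-on-T φ) v)) (∣0 K)))
    vanishes-off-T : ∀ e → e ∉ T → K ∣ℤ.∣ ψ e
    vanishes-off-T e e∉T = subst (K ∣ℤ.∣_) (sym ψₑ≡0) (∣0 K)
      where
      ψₑ≡0 : ψ e ≡ + 0
      ψₑ≡0 = trans (cong (_-_ (val G φ e)) (trans (cycleSum-off-forest _ (restrict-on-T φ) e e∉T)
                                                  (restrict-off-T φ e e∉T)))
                   (ℤP.+-inverseʳ (val G φ e))

  flow≡residue : ∀ φ → IsFlow G k φ → ∀ e → toℕ (lookup φ e) ≡ cycleSum (lookup (restrict φ)) e ℤ.%ℕ k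
  flow≡residue φ flow e =
    residue-unique _ _ (FinP.toℕ<n (lookup φ e)) (ℤDM.n%ℕd<d y k)
      (subst (K ∣ℤ.∣_) (difference (val G φ e) y (+ (y ℤ.%ℕ k)))
        (∣ℤ.∣m∣n⇒∣m-n (flow-congruent φ flow e) (residue-congruent y)))
    where
    y : ℤ
    y = cycleSum (lookup (restrict φ)) e
    difference : ∀ a b c → (a - b) - (c - b) ≡ a - c
    difference = solve-∀

  reduce-nowhere-zero-flow : ∀ z → LatticePoint T C k z → NowhereZeroFlow G k (reduce z)
  reduce-nowhere-zero-flow z lattice@(z≡0-on-T , _ , off-𝓗) = flow , nowhere-zero
    where
    y : Fin m → ℤ
    y = cycleSum (lookup z)
    val≡residue : ∀ e → val G (reduce z) e ≡ + (y e ℤ.%ℕ k)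
    val≡residue e = cong +_ (toℕ-reduce z e)
    -- (reduce z) ≡ zC mod k, and zC is a circulation
    flow : IsFlow G k (reduce z)
    flow = k∣netFlow⇒flow (reduce z) λ v →
      subst (K ∣ℤ.∣_) (trans (cong (_-_ (netFlow v (val G (reduce z))))
                                   (cycleSum-circulation (lookup z) z≡0-on-T v))
                             (ℤP.+-identityʳ _))
        (netFlow-congruent v (val G (reduce z)) y
          (λ e → subst (λ x → K ∣ℤ.∣ (x - y e)) (sym (val≡residue e)) (residue-congruent (y e))))
    -- a zero value on T would put z / k on a hyperplane; off T the value is z itself
    nowhere-zero : ∀ e → toℕ (lookup (reduce z) e) ≢ 0
    nowhere-zero e value≡0 with e ∈? T
    ... | yes e∈T = off-𝓗 (e , e∈T , quotient , on-H)
      where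
      K∣y : K ∣ℤ.∣ y e
      K∣y = residue≡0⇒∣ (y e) (trans (sym (toℕ-reduce z e)) value≡0)
      quotient : ℤ
      quotient = ∣ℤ._∣_.quotient K∣y
      on-H : OnHyperplane T C e quotient (λ f → lookup z f ℚ./ k)
      on-H = trans (hyperplane-value (lookup z) z≡0-on-T e) (/k≡/1⇐ (y e) quotient (∣ℤ._∣_.equality K∣y))
    ... | no  e∉T with lattice-value z lattice e e∉T
    ...   | r , _ , 0<r , _ , residue≡r =
      ℕP.<⇒≢ 0<r (sym (trans (sym residue≡r) (trans (sym (toℕ-reduce z e)) value≡0)))

  restrict-lattice-point : ∀ φ → NowhereZeroFlow G k φ → LatticePoint T C k (restrict φ)
  restrict-lattice-point φ (flow , nonzero) = restrict-on-T φ , in-cube , off-𝓗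
    where
    z : Fin m → ℤ
    z = lookup (restrict φ)
    in-cube : InOpenCube T (λ f → z f ℚ./ k)
    in-cube f f∉T rewrite restrict-off-T φ f f∉T =
      0</k⇐ _ (ℤ.+<+ (ℕP.n≢0⇒n>0 (nonzero f))) , /k<1⇐ _ (ℤ.+<+ (FinP.toℕ<n (lookup φ f)))
    -- on H_{e,d}, the residue of (zC)_e, which is the value of φ at e, would vanish
    off-𝓗 : ¬ InArrangement T C (λ f → z f ℚ./ k)
    off-𝓗 (e , e∈T , d , on-H) =
      nonzero e (trans (flow≡residue φ flow e)
                       (∣⇒residue≡0 _ (on-hyperplane⇒∣ z (restrict-on-T φ) e d on-H)))

  restrict∘reduce : ∀ z → LatticePoint T C k z → restrict (reduce z) ≡ z
  restrict∘reduce z lattice = Vec-ext _ _ same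
    where
    same : ∀ e → lookup (restrict (reduce z)) e ≡ lookup z e
    same e with e ∈? T
    ... | yes e∈T = trans (restrict-on-T (reduce z) e e∈T) (sym (proj₁ lattice e e∈T))
    ... | no  e∉T with lattice-value z lattice e e∉T
    ...   | r , z≡r , _ , _ , residue≡r =
      trans (restrict-off-T (reduce z) e e∉T) (trans (cong +_ (trans (toℕ-reduce z e) residue≡r)) (sym z≡r))

  reduce∘restrict : ∀ φ → IsFlow G k φ → reduce (restrict φ) ≡ φ
  reduce∘restrict φ flow =
    Vec-ext _ _ (λ e → FinP.toℕ-injective (trans (toℕ-reduce (restrict φ) e) (sym (flow≡residue φ flow e))))

  nowhereZeroFlow? : ∀ φ → Dec (NowhereZeroFlow G k φ)
  nowhereZeroFlow? φ = FinP.all? (λ v → _ ℕD.∣? _) ×-dec FinP.all? (λ e → ¬? (toℕ (lookup φ e) ℕ.≟ 0))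

proposition3p4 : ∀ {n m} (G : Graph n m) (T : Subset m) (C : Fin m → Fin m → ℤ)
                 → IsSpanningForest G T → IsFundCycleMatrix G T C
                 → (k : ℕ) .{{_ : NonZero k}}
                 → ∃[ N ] (HasSize (NowhereZeroFlow G k) N × HasSize (LatticePoint T C k) N)
proposition3p4 G T C (forest , _) fundamental (suc k′) =
  proj₁ flows-counted , proj₂ flows-counted ,
  HasSize-transport restrict reduce restrict-lattice-point reduce-nowhere-zero-flow
                    (λ φ → reduce∘restrict φ ∘ proj₁) restrict∘reduce (proj₂ flows-counted)
  where
  open Correspondence G T C fundamental forest k′
  flows-counted : ∃[ N ] HasSize (NowhereZeroFlow G (suc k′)) N
  flows-counted = HasSize-decidable nowhereZeroFlow?
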